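{- Let $m>1$ be an integer. If $(a,b,c)$ is an ordered $m$-Markoff triple, then $3ab<b+c$.
   Context: An $m$-Markoff triple is a triple $(a,b,c)$ of positive integers with $a^2+b^2+c^2=3abc+m$; it is ordered if $a\le b\le c$. -}

module Defs where

open import Data.Nat using (ℕ; _+_; _*_; _≤_; _<_)
open import Data.Product using (_×_)
open import Relation.Binary.PropositionalEquality using (_≡_)

-- Since m > 1 in the statement, all terms are
-- natural numbers and the equation can be stated in ℕ without loss.
IsMarkoff : ℕ → ℕ → ℕ → ℕ → Set
IsMarkoff m a b c =
  (0 < a) × (0 < b) × (0 < c) ×
  (a * a + b * b + c * c ≡ 3 * a * b * c + m)

IsOrderedMarkoff : ℕ → ℕ → ℕ → ℕ → Set
IsOrderedMarkoff m a b c = IsMarkoff m a b c × (a ≤ b) × (b ≤ c)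

{-# OPTIONS --safe #-}
module Submission where

-- Viewing the Markoff equation as a quadratic in c, the second root is
-- c' = 3ab − c, and c c' = a² + b² − m.  If 3ab ≥ b + c then both roots are
-- at least b, so (c − b)(c' − b) ≥ 0, i.e. 3ab·b + m ≤ a² + 2b².  But
-- a ≤ b and a ≥ 1 give a² + 2b² ≤ 3b² ≤ 3ab·b, forcing m = 0.

open import Defs
open import Data.Nat using (ℕ; _+_; _*_; _<_; _≤_; _<?_)
open import Data.Nat.Properties
open import Data.Nat.Tactic.RingSolver using (solve-∀)
open import Data.Product using (_,_)
open import Relation.Binary.PropositionalEquality
open import Relation.Nullary using (yes; no; contradiction)

-- The roots are written c = b + x and c' = b + y, so that their sum is
-- b + c + y and the product (c − b)(c' − b) is x y, with no subtraction.
markoff-root-shift : ∀ a b x y m →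
  a * a + b * b + (b + x) * (b + x) ≡ (b + (b + x) + y) * (b + x) + m →
  a * a + 2 * (b * b) ≡ (b + (b + x) + y) * b + (x * y + m)
markoff-root-shift a b x y m eq = +-cancelʳ-≡ (x * (b + (b + x))) _ _ (begin
  a * a + 2 * (b * b) + x * (b + (b + x))        ≡⟨ lhs a b x ⟩
  a * a + b * b + (b + x) * (b + x)              ≡⟨ eq ⟩
  (b + (b + x) + y) * (b + x) + m                ≡⟨ rhs b x y m ⟩
  (b + (b + x) + y) * b + (x * y + m) + x * (b + (b + x)) ∎)
  where
  open ≡-Reasoning
  lhs : ∀ a b x → a * a + 2 * (b * b) + x * (b + (b + x)) ≡ a * a + b * b + (b + x) * (b + x)
  lhs = solve-∀
  rhs : ∀ b x y m → (b + (b + x) + y) * (b + x) + m ≡ (b + (b + x) + y) * b + (x * y + m) + x * (b + (b + x))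
  rhs = solve-∀

square+2*square≤3*a*b*b : ∀ {a b} → 0 < a → a ≤ b → a * a + 2 * (b * b) ≤ 3 * a * b * b
square+2*square≤3*a*b*b {a} {b} 0<a a≤b = begin
  a * a + 2 * (b * b)  ≤⟨ +-monoˡ-≤ (2 * (b * b)) (*-mono-≤ a≤b a≤b) ⟩
  b * b + 2 * (b * b)  ≡⟨ three-squares b ⟩
  1 * (3 * (b * b))    ≤⟨ *-monoˡ-≤ (3 * (b * b)) 0<a ⟩
  a * (3 * (b * b))    ≡⟨ reassociate a b ⟩
  3 * a * b * b        ∎
  where
  open ≤-Reasoning
  three-squares : ∀ b → b * b + 2 * (b * b) ≡ 1 * (3 * (b * b))
  three-squares = solve-∀
  reassociate : ∀ a b → a * (3 * (b * b)) ≡ 3 * a * b * b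
  reassociate = solve-∀

markoff-large-second-root⇒m≡0 : ∀ {m a b x y} → 0 < a → a ≤ b →
  a * a + b * b + (b + x) * (b + x) ≡ 3 * a * b * (b + x) + m →
  b + (b + x) + y ≡ 3 * a * b → m ≡ 0
markoff-large-second-root⇒m≡0 {m} {a} {b} {x} {y} 0<a a≤b eq roots-sum =
  n≤0⇒n≡0 (m+n≤o⇒n≤o (x * y) (+-cancelˡ-≤ (3 * a * b * b) _ _ (begin
    3 * a * b * b + (x * y + m)  ≡⟨ sym shifted ⟩
    a * a + 2 * (b * b)          ≤⟨ square+2*square≤3*a*b*b 0<a a≤b ⟩
    3 * a * b * b                ≡⟨ sym (+-identityʳ _) ⟩
    3 * a * b * b + 0            ∎)))
  where
  open ≤-Reasoning
  shifted : a * a + 2 * (b * b) ≡ 3 * a * b * b + (x * y + m)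
  shifted = subst (λ s → a * a + 2 * (b * b) ≡ s * b + (x * y + m)) roots-sum
    (markoff-root-shift a b x y m
      (subst (λ s → a * a + b * b + (b + x) * (b + x) ≡ s * (b + x) + m) (sym roots-sum) eq))

lemma2p1 : (m a b c : ℕ) → 1 < m → IsOrderedMarkoff m a b c →
    3 * a * b < b + c
lemma2p1 m a b c m>1 ((0<a , _ , _ , eq) , a≤b , b≤c) with 3 * a * b <? b + c
... | yes 3ab<b+c = 3ab<b+c
... | no 3ab≮b+c with m≤n⇒∃[o]m+o≡n b≤c | m≤n⇒∃[o]m+o≡n (≮⇒≥ 3ab≮b+c)
...   | x , refl | y , roots-sum =
  contradiction (markoff-large-second-root⇒m≡0 0<a a≤b eq roots-sum) (>⇒≢ (<⇒≤ m>1))
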